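{- Let $R$ be a semi-simple commutative unitary ring. Then the residuated lattice $(Id(R),\cap,+,\odot,\rightarrow,\{0\},R)$ of ideals of $R$ is semi-simple.
   Context: A commutative unitary ring is semi-simple if it is a direct product of finitely many fields. For ideals $I,J$ of $R$: $I+J=\{i+j\}$, $I\odot J$ is the ideal product $\{\sum_k i_kj_k\}$, and $I\rightarrow J=\{x\in R\mid xI\subseteq J\}$; with inclusion order this is a residuated lattice (an algebra with bounded lattice reduct, commutative monoid $(\odot,R)$, and $I\odot K\subseteq J$ iff $K\subseteq I\rightarrow J$). A filter of a residuated lattice is a nonempty subset closed under $\odot$ and upward closed; a filter $T$ is simple if $T\neq\{1\}$ and the only filters contained in $T$ are $\{1\}$ and $T$; a residuated lattice $L$ is semi-simple if $L\neq\{1\}$ and $L$ is the smallest filter containing the union of some non-empty family of simple filters. -}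

module Defs where

open import Level using (Level; _⊔_; suc; Lift; lift)
open import Algebra.Bundles using (CommutativeRing)
open import Data.Fin using (Fin)
open import Data.Nat using (ℕ)
open import Data.Product using (Σ; ∃; _×_; _,_)
open import Data.Sum using (_⊎_)
open import Data.Unit.Polymorphic using (⊤)
open import Relation.Nullary using (¬_)

-- These notions only involve the carrier, the lattice order _≤_, the
-- monoid operation _⊙_ and the top element 𝟙, so they are stated
-- over exactly that data.

module FilterTheory {a r : Level} (A : Set a) (_≤_ : A → A → Set r)
                    (_⊙_ : A → A → A) (𝟙 : A) (p : Level) where

  _≈_ : A → A → Set r
  x ≈ y = (x ≤ y) × (y ≤ x)

  Subset : Set (a ⊔ suc p)
  Subset = A → Set p

  _⊆_ : ∀ {q s} → (A → Set q) → (A → Set s) → Set (a ⊔ q ⊔ s)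
  F ⊆ G = ∀ x → F x → G x

  _≐_ : ∀ {q s} → (A → Set q) → (A → Set s) → Set (a ⊔ q ⊔ s)
  F ≐ G = (F ⊆ G) × (G ⊆ F)

  One : A → Set r
  One x = x ≈ 𝟙

  Whole : Subset
  Whole _ = ⊤

  IsFilter : Subset → Set (a ⊔ r ⊔ p)
  IsFilter F = (∃ λ x → F x)
             × (∀ x y → F x → F y → F (x ⊙ y))
             × (∀ x y → F x → x ≤ y → F y)

  IsSimpleFilter : Subset → Set (a ⊔ r ⊔ suc p)
  IsSimpleFilter T = IsFilter T
                   × ¬ (T ≐ One)
                   × (∀ (F : Subset) → IsFilter F → F ⊆ T → (F ≐ One) ⊎ (F ≐ T))

  IsSmallestFilterContaining : Subset → Subset → Set (a ⊔ r ⊔ suc p)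
  IsSmallestFilterContaining S F =
    IsFilter F × (S ⊆ F) × (∀ (G : Subset) → IsFilter G → S ⊆ G → F ⊆ G)

  IsSemiSimple : Set (a ⊔ r ⊔ suc p)
  IsSemiSimple =
    ¬ (Whole ≐ One)
    × Σ (Set p) λ I → I × Σ (I → Subset) λ T →
        (∀ i → IsSimpleFilter (T i))
        × IsSmallestFilterContaining (λ x → ∃ λ i → T i x) Whole

module IdealTheory {c ℓ : Level} (R : CommutativeRing c ℓ) where
  open CommutativeRing R

  record Ideal : Set (suc (c ⊔ ℓ)) where
    field
      P    : Carrier → Set (c ⊔ ℓ)
      resp : ∀ {x y} → x ≈ y → P x → P y
      has0 : P 0#
      add  : ∀ {x y} → P x → P y → P (x + y)
      mul  : ∀ r {x} → P x → P (r * x)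
  open Ideal public

  _⊆ᵢ_ : Ideal → Ideal → Set (c ⊔ ℓ)
  I ⊆ᵢ J = ∀ x → P I x → P J x

  -- I ⊙ J : the ideal generated by the products i j  (= all finite sums Σ i_k j_k)
  data ProdGen (I J : Ideal) : Carrier → Set (c ⊔ ℓ) where
    gen   : ∀ {x a b} → P I a → P J b → x ≈ a * b → ProdGen I J x
    zer   : ∀ {x} → x ≈ 0# → ProdGen I J x
    plus  : ∀ {x a b} → ProdGen I J a → ProdGen I J b → x ≈ a + b → ProdGen I J x
    scale : ∀ {x r a} → ProdGen I J a → x ≈ r * a → ProdGen I J x

  private
    prodResp : ∀ {I J x y} → x ≈ y → ProdGen I J x → ProdGen I J y
    prodResp e (gen p q e')   = gen p q (trans (sym e) e')
    prodResp e (zer e')       = zer (trans (sym e) e')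
    prodResp e (plus p q e')  = plus p q (trans (sym e) e')
    prodResp e (scale p e')   = scale p (trans (sym e) e')

  _⊙_ : Ideal → Ideal → Ideal
  I ⊙ J = record
    { P    = ProdGen I J
    ; resp = prodResp
    ; has0 = zer refl
    ; add  = λ p q → plus p q refl
    ; mul  = λ r p → scale p refl
    }

  unitIdeal : Ideal
  unitIdeal = record
    { P = λ _ → ⊤ ; resp = λ _ _ → _ ; has0 = _ ; add = λ _ _ → _ ; mul = λ _ _ → _ }

  module IdFilters = FilterTheory Ideal _⊆ᵢ_ _⊙_ unitIdeal (c ⊔ ℓ)

  IdealLatticeSemiSimple : Set (suc (c ⊔ ℓ))
  IdealLatticeSemiSimple = IdFilters.IsSemiSimple

IsField : ∀ {c ℓ} → CommutativeRing c ℓ → Set (c ⊔ ℓ)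
IsField K = ¬ (1# ≈ 0#) × (∀ x → ¬ (x ≈ 0#) → ∃ λ y → x * y ≈ 1#)
  where open CommutativeRing K

record IsRingIsoToProduct {c ℓ c₂ ℓ₂ : Level} {n : ℕ} (R : CommutativeRing c ℓ)
         (K : Fin n → CommutativeRing c₂ ℓ₂)
         (f : CommutativeRing.Carrier R → (i : Fin n) → CommutativeRing.Carrier (K i))
         : Set (c ⊔ ℓ ⊔ c₂ ⊔ ℓ₂) where
  module R = CommutativeRing R
  module K (i : Fin n) = CommutativeRing (K i)
  field
    cong  : ∀ {x y} → x R.≈ y → ∀ i → K._≈_ i (f x i) (f y i)
    hom+  : ∀ x y i → K._≈_ i (f (x R.+ y) i) (K._+_ i (f x i) (f y i))
    hom*  : ∀ x y i → K._≈_ i (f (x R.* y) i) (K._*_ i (f x i) (f y i))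
    hom1  : ∀ i → K._≈_ i (f R.1# i) (K.1# i)
    inj   : ∀ {x y} → (∀ i → K._≈_ i (f x i) (f y i)) → x R.≈ y
    surj  : ∀ (z : (i : Fin n) → K.Carrier i) → ∃ λ x → ∀ i → K._≈_ i (f x i) (z i)

IsSemiSimpleRing : ∀ {c ℓ} (c₂ ℓ₂ : Level) → CommutativeRing c ℓ → Set (c ⊔ ℓ ⊔ suc (c₂ ⊔ ℓ₂))
IsSemiSimpleRing c₂ ℓ₂ R =
  Σ ℕ λ n → Σ (Fin (ℕ.suc n) → CommutativeRing c₂ ℓ₂) λ K →
    (∀ i → IsField (K i)) × ∃ λ f → IsRingIsoToProduct R K f

{-# OPTIONS --safe #-}
module Submission where

-- Write R ≅ K₀ × ⋯ × Kₙ and let Mᵢ be the kernel of the i-th projection, i.e. the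
-- annihilator of the idempotent eᵢ = (0,…,1,…,0).  Since x = (1 − eᵢ) x on Mᵢ and
-- 1 − eᵢ ∈ Mᵢ, the ideal Mᵢ is idempotent, so ↑Mᵢ = {J | Mᵢ ⊆ J} is a filter; as Mᵢ is
-- maximal, a subfilter of ↑Mᵢ either consists of R alone or contains Mᵢ, so ↑Mᵢ is
-- simple.  A filter containing every Mᵢ contains M₀ ⊙ ⋯ ⊙ Mₙ ⊆ ⋂ Mᵢ = 0, hence
-- every ideal.

open import Defs
open import Level using (Level; _⊔_; suc; Lift; lift; lower)
open import Algebra.Bundles using (CommutativeRing)
open import Axiom.ExcludedMiddle using (ExcludedMiddle)
open import Data.Nat as ℕ using (ℕ)
open import Data.Fin as Fin using (Fin)
open import Data.Vec.Functional using (foldr)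
open import Data.Product using (∃; _×_; _,_; proj₁; proj₂)
open import Data.Sum using (_⊎_; inj₁; inj₂)
open import Data.Empty using (⊥-elim)
open import Relation.Nullary using (¬_; yes; no)
open import Relation.Nullary.Decidable using (map′)
open import Relation.Binary.PropositionalEquality as ≡ using (_≢_)
import Relation.Binary.Reasoning.Setoid as SetoidReasoning

lowerExcludedMiddle : ∀ {a} b → ExcludedMiddle (a ⊔ b) → ExcludedMiddle a
lowerExcludedMiddle b em = map′ lower lift (em {Lift b _})

module FilterProperties {a r : Level} {A : Set a} (_≤_ : A → A → Set r)
  (_⊙_ : A → A → A) (𝟙 : A)
  (≤-refl : ∀ {x} → x ≤ x)
  (≤-trans : ∀ {x y z} → x ≤ y → y ≤ z → x ≤ z)
  (≤-𝟙 : ∀ {x} → x ≤ 𝟙) where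

  open FilterTheory A _≤_ _⊙_ 𝟙 r

  infix 30 ↑_
  ↑_ : A → Subset
  (↑ m) x = m ≤ x

  ↑-isFilter : (∀ {x x′ y y′} → x ≤ x′ → y ≤ y′ → (x ⊙ y) ≤ (x′ ⊙ y′)) →
               ∀ {m} → m ≤ (m ⊙ m) → IsFilter (↑ m)
  ↑-isFilter ⊙-mono m≤m⊙m =
    (_ , ≤-refl) , (λ _ _ m≤x m≤y → ≤-trans m≤m⊙m (⊙-mono m≤x m≤y)) , λ _ _ → ≤-trans

  ↑-isSimpleFilter : ExcludedMiddle (a ⊔ r) → ∀ {m} → IsFilter (↑ m) → ¬ (𝟙 ≤ m) →
                     (∀ x → m ≤ x → 𝟙 ≤ x ⊎ x ≤ m) → IsSimpleFilter (↑ m)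
  ↑-isSimpleFilter em {m} ↑m-filter 𝟙≰m maximal = ↑m-filter , ↑m≉One , minimal
    where
    ↑m≉One : ¬ (↑ m ≐ One)
    ↑m≉One (↑m⊆One , _) = 𝟙≰m (proj₂ (↑m⊆One m ≤-refl))

    minimal : ∀ F → IsFilter F → F ⊆ ↑ m → (F ≐ One) ⊎ (F ≐ ↑ m)
    minimal F ((x₀ , Fx₀) , _ , F-up) F⊆↑m with em {∃ λ x → F x × x ≤ m}
    ... | yes (x , Fx , x≤m) = inj₂ (F⊆↑m , λ y m≤y → F-up x y Fx (≤-trans x≤m m≤y))
    ... | no ∄x≤m = inj₁ (F⊆One , λ y (_ , 𝟙≤y) → F-up x₀ y Fx₀ (≤-trans ≤-𝟙 𝟙≤y))
      where
      F⊆One : F ⊆ One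
      F⊆One x Fx with maximal x (F⊆↑m x Fx)
      ... | inj₁ 𝟙≤x = ≤-𝟙 , 𝟙≤x
      ... | inj₂ x≤m = ⊥-elim (∄x≤m (x , Fx , x≤m))

  filter-∋-foldr : ∀ {F} → IsFilter F → ∀ {n} (g : Fin n → A) → (∀ i → F (g i)) →
                   F (foldr _⊙_ 𝟙 g)
  filter-∋-foldr ((x₀ , Fx₀) , _ , F-up) {ℕ.zero} g Fg = F-up x₀ 𝟙 Fx₀ ≤-𝟙
  filter-∋-foldr F-filter@(_ , F-⊙ , _) {ℕ.suc n} g Fg =
    F-⊙ _ _ (Fg Fin.zero) (filter-∋-foldr F-filter (λ i → g (Fin.suc i)) (λ i → Fg (Fin.suc i)))

  Whole≉One : ∀ {x} → ¬ (𝟙 ≤ x) → ¬ (Whole ≐ One)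
  Whole≉One 𝟙≰x (Whole⊆One , _) = 𝟙≰x (proj₂ (Whole⊆One _ _))

  Whole-isSmallestFilterContaining : ∀ {S : Subset} {n} (g : Fin n → A) → (∀ i → S (g i)) →
    (∀ x → foldr _⊙_ 𝟙 g ≤ x) → IsSmallestFilterContaining S Whole
  Whole-isSmallestFilterContaining g Sg ∏g≤ =
    ((𝟙 , _) , _ , _) , _ , λ G G-filter@(_ , _ , G-up) S⊆G x _ →
      G-up _ x (filter-∋-foldr G-filter g (λ i → S⊆G (g i) (Sg i))) (∏g≤ x)


module IdealProperties {c ℓ : Level} (R : CommutativeRing c ℓ) where

  open CommutativeRing R
  open IdealTheory R
  open import Algebra.Properties.Ring ring using ([y-z]x≈yx-zx; -0#≈0#)
  open import Algebra.Definitions _≈_ using (_IdempotentOn_)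
  open SetoidReasoning setoid

  module IdealFilters = FilterProperties _⊆ᵢ_ _⊙_ unitIdeal
    (λ _ x∈I → x∈I) (λ I⊆J J⊆K x x∈I → J⊆K x (I⊆J x x∈I)) (λ _ _ → _)

  1∈⇒unitIdeal⊆ : ∀ {J} → P J 1# → unitIdeal ⊆ᵢ J
  1∈⇒unitIdeal⊆ {J} 1∈J x _ = resp J (*-identityʳ x) (mul J x 1∈J)

  ≈0⇒∈ : ∀ J {x} → x ≈ 0# → P J x
  ≈0⇒∈ J x≈0 = resp J (sym x≈0) (has0 J)

  ⊙-least : ∀ {I J} K → (∀ {a b} → P I a → P J b → P K (a * b)) → (I ⊙ J) ⊆ᵢ K
  ⊙-least K ab∈K x (gen a∈I b∈J x≈ab) = resp K (sym x≈ab) (ab∈K a∈I b∈J)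
  ⊙-least K ab∈K x (zer x≈0)          = ≈0⇒∈ K x≈0
  ⊙-least K ab∈K x (plus p q x≈a+b)   = resp K (sym x≈a+b) (add K (⊙-least K ab∈K _ p) (⊙-least K ab∈K _ q))
  ⊙-least K ab∈K x (scale p x≈ra)     = resp K (sym x≈ra) (mul K _ (⊙-least K ab∈K _ p))

  ⊙-mono : ∀ {I I′ J J′} → I ⊆ᵢ I′ → J ⊆ᵢ J′ → (I ⊙ J) ⊆ᵢ (I′ ⊙ J′)
  ⊙-mono {I′ = I′} {J′ = J′} I⊆I′ J⊆J′ =
    ⊙-least (I′ ⊙ J′) λ a∈I b∈J → gen (I⊆I′ _ a∈I) (J⊆J′ _ b∈J) refl

  ⊙-⊆ˡ : ∀ I J → (I ⊙ J) ⊆ᵢ I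
  ⊙-⊆ˡ I J = ⊙-least I λ {a} {b} a∈I _ → resp I (*-comm b a) (mul I b a∈I)

  ⊙-⊆ʳ : ∀ I J → (I ⊙ J) ⊆ᵢ J
  ⊙-⊆ʳ I J = ⊙-least J λ {a} _ b∈J → mul J a b∈J

  foldr-⊙-⊆ : ∀ {n} (I : Fin n → Ideal) i → foldr _⊙_ unitIdeal I ⊆ᵢ I i
  foldr-⊙-⊆ I Fin.zero    = ⊙-⊆ˡ (I Fin.zero) _
  foldr-⊙-⊆ I (Fin.suc i) x p =
    foldr-⊙-⊆ (λ j → I (Fin.suc j)) i x (⊙-⊆ʳ (I Fin.zero) _ x p)

  annihilator : Carrier → Ideal
  annihilator e = record
    { P    = λ x → Lift c (x * e ≈ 0#)
    ; resp = λ x≈y (lift xe≈0) → lift (trans (*-congʳ (sym x≈y)) xe≈0)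
    ; has0 = lift (zeroˡ e)
    ; add  = λ (lift xe≈0) (lift ye≈0) →
               lift (trans (distribʳ e _ _) (trans (+-cong xe≈0 ye≈0) (+-identityʳ 0#)))
    ; mul  = λ r (lift xe≈0) → lift (trans (*-assoc r _ e) (trans (*-congˡ xe≈0) (zeroʳ r)))
    }

  module _ {e : Carrier} (e-idem : _*_ IdempotentOn e) where

    1-e∈annihilator : P (annihilator e) (1# - e)
    1-e∈annihilator = lift (begin
      (1# - e) * e     ≈⟨ [y-z]x≈yx-zx e 1# e ⟩
      1# * e - e * e   ≈⟨ +-cong (*-identityˡ e) (-‿cong e-idem) ⟩
      e - e            ≈⟨ -‿inverseʳ e ⟩
      0#               ∎)

    1-e-acts-on-annihilator : ∀ {x} → P (annihilator e) x → x ≈ (1# - e) * x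
    1-e-acts-on-annihilator {x} (lift xe≈0) = sym (begin
      (1# - e) * x     ≈⟨ [y-z]x≈yx-zx x 1# e ⟩
      1# * x - e * x   ≈⟨ +-cong (*-identityˡ x) (-‿cong (trans (*-comm e x) xe≈0)) ⟩
      x - 0#           ≈⟨ +-congˡ -0#≈0# ⟩
      x + 0#           ≈⟨ +-identityʳ x ⟩
      x                ∎)

    annihilator-⊆-⊙ : annihilator e ⊆ᵢ (annihilator e ⊙ annihilator e)
    annihilator-⊆-⊙ x x∈ = gen 1-e∈annihilator x∈ (1-e-acts-on-annihilator x∈)

    annihilator⊆-∋-e⇒∋1 : ∀ {J} → annihilator e ⊆ᵢ J → P J e → P J 1#
    annihilator⊆-∋-e⇒∋1 {J} ann⊆J e∈J = resp J 1-e+e≈1 (add J (ann⊆J _ 1-e∈annihilator) e∈J)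
      where
      1-e+e≈1 : (1# - e) + e ≈ 1#
      1-e+e≈1 = begin
        (1# - e) + e     ≈⟨ +-assoc 1# (- e) e ⟩
        1# + (- e + e)   ≈⟨ +-congˡ (-‿inverseˡ e) ⟩
        1# + 0#          ≈⟨ +-identityʳ 1# ⟩
        1#               ∎

    annihilator-maximal : ExcludedMiddle (c ⊔ ℓ) →
      (∀ x → ¬ P (annihilator e) x → ∃ λ y → e ≈ y * x) →
      ∀ {J} → annihilator e ⊆ᵢ J → unitIdeal ⊆ᵢ J ⊎ J ⊆ᵢ annihilator e
    annihilator-maximal em generates-e {J} ann⊆J with em {P J 1#}
    ... | yes 1∈J = inj₁ (1∈⇒unitIdeal⊆ {J} 1∈J)
    ... | no 1∉J = inj₂ J⊆ann
      where
      J⊆ann : J ⊆ᵢ annihilator e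
      J⊆ann x x∈J with em {P (annihilator e) x}
      ... | yes x∈ann = x∈ann
      ... | no x∉ann with generates-e x x∉ann
      ... | y , e≈yx = ⊥-elim (1∉J (annihilator⊆-∋-e⇒∋1 {J} ann⊆J e∈J))
        where
        e∈J : P J e
        e∈J = resp J (sym e≈yx) (mul J y x∈J)

module ProductOfFields {c ℓ c₂ ℓ₂ : Level} {n : ℕ} (R : CommutativeRing c ℓ)
  (K : Fin n → CommutativeRing c₂ ℓ₂) (K-field : ∀ i → IsField (K i))
  (f : CommutativeRing.Carrier R → (i : Fin n) → CommutativeRing.Carrier (K i))
  (f-iso : IsRingIsoToProduct R K f) where

  module R = CommutativeRing R
  module Field (i : Fin n) = CommutativeRing (K i)
  open IsRingIsoToProduct f-iso using (hom*; hom1; inj; surj) renaming (cong to f-cong)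
  open IdealTheory R
  open IdealProperties R
  open IdealFilters

  unitVector : (i : Fin n) → Field.Carrier i → ∀ j → Field.Carrier j
  unitVector i a j with i Fin.≟ j
  ... | yes ≡.refl = a
  ... | no _       = Field.0# j

  unitVector-at : ∀ i a → unitVector i a i ≡.≡ a
  unitVector-at i a with i Fin.≟ i
  ... | yes ≡.refl = ≡.refl
  ... | no i≢i     = ⊥-elim (i≢i ≡.refl)

  unitVector-off : ∀ i a j → i ≢ j → unitVector i a j ≡.≡ Field.0# j
  unitVector-off i a j i≢j with i Fin.≟ j
  ... | yes i≡j = ⊥-elim (i≢j i≡j)
  ... | no _    = ≡.refl

  single : (i : Fin n) → Field.Carrier i → R.Carrier
  single i a = proj₁ (surj (unitVector i a))

  single-at : ∀ i a → Field._≈_ i (f (single i a) i) a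
  single-at i a = Field.trans i (proj₂ (surj (unitVector i a)) i) (Field.reflexive i (unitVector-at i a))

  single-off : ∀ i a j → i ≢ j → Field._≈_ j (f (single i a) j) (Field.0# j)
  single-off i a j i≢j =
    Field.trans j (proj₂ (surj (unitVector i a)) j) (Field.reflexive j (unitVector-off i a j i≢j))

  ≈-byCoordinates : ∀ i {x y} → Field._≈_ i (f x i) (f y i) →
    (∀ j → i ≢ j → Field._≈_ j (f x j) (f y j)) → x R.≈ y
  ≈-byCoordinates i at-i off-i = inj coordinate
    where
    coordinate : ∀ j → Field._≈_ j (f _ j) (f _ j)
    coordinate j with i Fin.≟ j
    ... | yes ≡.refl = at-i
    ... | no i≢j     = off-i j i≢j

  f-0# : ∀ j → Field._≈_ j (f R.0# j) (Field.0# j)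
  f-0# j = begin
    f R.0# j                          ≈⟨ f-cong (R.sym (R.zeroˡ z)) j ⟩
    f (R.0# R.* z) j                  ≈⟨ hom* R.0# z j ⟩
    f R.0# j * f z j                  ≈⟨ *-congˡ (single-at j 0#) ⟩
    f R.0# j * 0#                     ≈⟨ zeroʳ _ ⟩
    0#                                ∎
    where
    open Field j
    open SetoidReasoning setoid
    z = single j 0#

  single-0# : ∀ i → single i (Field.0# i) R.≈ R.0#
  single-0# i = ≈-byCoordinates i
    (Field.trans i (single-at i _) (Field.sym i (f-0# i)))
    (λ j i≢j → Field.trans j (single-off i _ j i≢j) (Field.sym j (f-0# j)))

  single-cong : ∀ i {a b} → Field._≈_ i a b → single i a R.≈ single i b
  single-cong i a≈b = ≈-byCoordinates i
    (Field.trans i (single-at i _) (Field.trans i a≈b (Field.sym i (single-at i _))))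
    (λ j i≢j → Field.trans j (single-off i _ j i≢j) (Field.sym j (single-off i _ j i≢j)))

  *-single : ∀ x i a → x R.* single i a R.≈ single i (Field._*_ i (f x i) a)
  *-single x i a = ≈-byCoordinates i at-i off-i
    where
    at-i : Field._≈_ i (f (x R.* single i a) i) (f (single i (Field._*_ i (f x i) a)) i)
    at-i = begin
      f (x R.* single i a) i          ≈⟨ hom* x _ i ⟩
      f x i * f (single i a) i        ≈⟨ *-congˡ (single-at i a) ⟩
      f x i * a                       ≈⟨ single-at i _ ⟨
      f (single i (f x i * a)) i      ∎
      where
      open Field i
      open SetoidReasoning setoid
    off-i : ∀ j → i ≢ j → Field._≈_ j (f (x R.* single i a) j) (f (single i _) j)
    off-i j i≢j = begin
      f (x R.* single i a) j          ≈⟨ hom* x _ j ⟩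
      f x j * f (single i a) j        ≈⟨ *-congˡ (single-off i a j i≢j) ⟩
      f x j * 0#                      ≈⟨ zeroʳ _ ⟩
      0#                              ≈⟨ single-off i _ j i≢j ⟨
      f (single i _) j                ∎
      where
      open Field j
      open SetoidReasoning setoid

  idempotentAt : Fin n → R.Carrier
  idempotentAt i = single i (Field.1# i)

  idempotentAt-idempotent : ∀ i → idempotentAt i R.* idempotentAt i R.≈ idempotentAt i
  idempotentAt-idempotent i = R.trans (*-single (idempotentAt i) i _)
    (single-cong i (Field.trans i (Field.*-identityʳ i _) (single-at i _)))

  -- Membership in an ideal must live at level c ⊔ ℓ, so the kernel of the i-th
  -- projection is expressed inside R rather than by f x i ≈ 0.
  ker : Fin n → Ideal
  ker i = annihilator (idempotentAt i)

  ∈ker⇒≈0 : ∀ i {x} → P (ker i) x → Field._≈_ i (f x i) (Field.0# i)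
  ∈ker⇒≈0 i {x} (lift xe≈0) = begin
    f x i                             ≈⟨ *-identityʳ _ ⟨
    f x i * 1#                        ≈⟨ single-at i _ ⟨
    f (single i (f x i * 1#)) i       ≈⟨ f-cong (*-single x i 1#) i ⟨
    f (x R.* idempotentAt i) i        ≈⟨ f-cong xe≈0 i ⟩
    f R.0# i                          ≈⟨ f-0# i ⟩
    0#                                ∎
    where
    open Field i
    open SetoidReasoning setoid

  ≈0⇒∈ker : ∀ i {x} → Field._≈_ i (f x i) (Field.0# i) → P (ker i) x
  ≈0⇒∈ker i {x} xᵢ≈0 = lift (begin
    x R.* idempotentAt i              ≈⟨ *-single x i _ ⟩
    single i (Field._*_ i (f x i) _)  ≈⟨ single-cong i (Field.trans i (Field.*-congʳ i xᵢ≈0) (Field.zeroˡ i _)) ⟩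
    single i (Field.0# i)             ≈⟨ single-0# i ⟩
    R.0#                              ∎)
    where open SetoidReasoning R.setoid

  unitIdeal⊈ker : ∀ i → ¬ (unitIdeal ⊆ᵢ ker i)
  unitIdeal⊈ker i unit⊆ker =
    proj₁ (K-field i) (Field.trans i (Field.sym i (hom1 i)) (∈ker⇒≈0 i (unit⊆ker R.1# _)))

  ⋂ker≈0 : ∀ {x} → (∀ i → P (ker i) x) → x R.≈ R.0#
  ⋂ker≈0 x∈ker = inj λ j → Field.trans j (∈ker⇒≈0 j (x∈ker j)) (Field.sym j (f-0# j))

  ∉ker⇒generates-idempotentAt : ∀ i x → ¬ P (ker i) x → ∃ λ y → idempotentAt i R.≈ y R.* x
  ∉ker⇒generates-idempotentAt i x x∉ker
    with proj₂ (K-field i) (f x i) (λ xᵢ≈0 → x∉ker (≈0⇒∈ker i xᵢ≈0))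
  ... | y , xᵢy≈1 = single i y , (begin
    single i (Field.1# i)             ≈⟨ single-cong i xᵢy≈1 ⟨
    single i (Field._*_ i (f x i) y)  ≈⟨ *-single x i y ⟨
    x R.* single i y                  ≈⟨ R.*-comm x _ ⟩
    single i y R.* x                  ∎)
    where open SetoidReasoning R.setoid

  foldr-⊙-ker⊆ : ∀ J → foldr _⊙_ unitIdeal ker ⊆ᵢ J
  foldr-⊙-ker⊆ J x x∈∏ = ≈0⇒∈ J (⋂ker≈0 λ i → foldr-⊙-⊆ ker i x x∈∏)

  ↑ker-isSimpleFilter : ExcludedMiddle (suc (c ⊔ ℓ)) → ∀ i → IdFilters.IsSimpleFilter (↑ ker i)
  ↑ker-isSimpleFilter em i =
    ↑-isSimpleFilter em {ker i}
      (↑-isFilter ⊙-mono (annihilator-⊆-⊙ (idempotentAt-idempotent i)))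
      (unitIdeal⊈ker i)
      (λ J → annihilator-maximal (idempotentAt-idempotent i) (lowerExcludedMiddle (suc (c ⊔ ℓ)) em)
               (∉ker⇒generates-idempotentAt i) {J})

theorem5p7 : ∀ {c ℓ c₂ ℓ₂ : Level} → ExcludedMiddle (suc (c ⊔ ℓ ⊔ c₂ ⊔ ℓ₂))
    → (R : CommutativeRing c ℓ) → IsSemiSimpleRing c₂ ℓ₂ R
    → IdealTheory.IdealLatticeSemiSimple R
theorem5p7 {c} {ℓ} {c₂} {ℓ₂} em R (n , K , K-field , f , f-iso) =
  Whole≉One {ker Fin.zero} (unitIdeal⊈ker Fin.zero) ,
  Lift (c ⊔ ℓ) (Fin (ℕ.suc n)) , lift Fin.zero , (λ (lift i) → ↑ ker i) ,
  (λ (lift i) → ↑ker-isSimpleFilter (lowerExcludedMiddle (suc (c ⊔ ℓ ⊔ c₂ ⊔ ℓ₂)) em) i) ,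
  Whole-isSmallestFilterContaining ker (λ i → lift i , λ _ x∈ker → x∈ker) foldr-⊙-ker⊆
  where
  open IdealProperties.IdealFilters R
  open ProductOfFields R K K-field f f-iso
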